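{- Let $G$ and $H$ be finite nonempty connected graphs each having at least one edge, $f\colon G\to H$ a graph homomorphism, $v\in V(G)$, $w=f(v)$, $\Gamma=\pi_1^2(G,v)$, universal 2-coverings $p_G\colon(\tilde G,\tilde v)\to(G,v)$, $p_H\colon(\tilde H,\tilde w)\to(H,w)$, and $\tilde f$ the based lift of $f$. Let $\varpi\in\pi_1^2(H,w)$. Then the following are equivalent: (1) $\varpi\in\Pi(f,v)$; (2) the graph homomorphism $\varpi\tilde f\colon\tilde x\mapsto\varpi(\tilde f(\tilde x))$ belongs to $\mathrm{Hom}^\Gamma(\tilde G,\tilde H)_{\tilde f}$.
   Context: Graphs allow loops; $N(x)$ neighborhood, $N^2(x)=\bigcup_{y\in N(x)}N(y)$. $\pi_1^2(G,v)$: group of classes of closed walks at $v$ under the equivalence generated by (A) $(x_0,\dots,x_m)\sim(x_0,\dots,x_k,y,x_k,\dots,x_m)$, $y$ adjacent to $x_k$, and (B) equal-length walks differing in at most one position. A 2-covering map restricts to bijections $N(x)\to N(p(x))$, $N^2(x)\to N^2(p(x))$; the universal 2-covering is the connected based 2-covering with trivial 2-fundamental group. $\pi_1^2(H,w)$ acts on $\tilde H$: for $g=[\gamma]$ and a walk $\varphi$ from $\tilde w$ to $\tilde y$, $g\tilde y$ is the endpoint of the lift from $\tilde w$ of $\gamma\cdot(p_H\circ\varphi)$; analogously $\Gamma$ acts on $\tilde G$, and $\Gamma$ acts on $\tilde H$ via $f_*$; $\tilde f$ (the based homomorphism with $p_H\circ\tilde f=f\circ p_G$) is $\Gamma$-equivariant.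 Multi-homomorphisms $\eta\colon V(\tilde G)\to\mathcal{P}(V(\tilde H))\setminus\{\emptyset\}$ with $\eta(x)\times\eta(y)\subseteq E(\tilde H)$ for edges $(x,y)$, ordered by pointwise inclusion, topologized by the order complex; graph homomorphisms identified with singleton-valued ones. $\mathrm{Hom}^\Gamma(\tilde G,\tilde H)$: those $\eta$ with $\eta(g\tilde x)=f_*(g)\eta(\tilde x)$; subscript $\tilde f$ denotes the connected component containing $\tilde f$. $\times$-homotopy from $f$ to $f$: graph homomorphism $h\colon G\times I_n\to H$ ($I_n$: vertices $0,\dots,n$, $i\sim j$ iff $|i-j|\le1$; categorical product) with $h(x,0)=h(x,n)=f(x)$. For $v'\in N_G(v)$, the class of the closed walk $(h(v,0),h(v',0),h(v,1),\dots,h(v',n-1),h(v,n))$ in $\pi_1^2(H,w)$ is independent of $v'$ and is realized by $h$; $\Pi(f,v)$ is the subgroup of elements realized by some such $h$. -}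

module Defs where

open import Level using (Level; _⊔_) renaming (suc to lsuc; zero to lzero)
open import Data.Nat using (ℕ; zero; suc; _≤_)
open import Data.Fin using (Fin)
open import Data.List using (List; []; _∷_; _++_; map; drop; concatMap; upTo)
open import Data.Product using (Σ; ∃; ∃-syntax; _×_; _,_; proj₁; proj₂)
open import Data.Sum using (_⊎_)
open import Function.Bundles using (_↔_)
open import Relation.Binary.PropositionalEquality using (_≡_)
open import Relation.Binary.Construct.Closure.Equivalence using (EqClosure)
open import Relation.Binary.Construct.Closure.ReflexiveTransitive using (Star)

-- Graphs (undirected, loops allowed; possibly infinite vertex set)

record Graph : Set₁ where
  field
    V   : Set
    E   : V → V → Set
    sym : ∀ {x y} → E x y → E y x
open Graph public

record Hom (G H : Graph) : Set where
  field
    fun  : V G → V H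
    pres : ∀ {x y} → E G x y → E H (fun x) (fun y)
open Hom public

Finite : Graph → Set
Finite G = Σ ℕ λ n → V G ↔ Fin n

HasEdge : Graph → Set
HasEdge G = Σ (V G) λ x → Σ (V G) λ y → E G x y

-- Walks, as vertex sequences (x₀ , … , xₘ) with consecutive vertices
-- adjacent.  IsWalk G x y l : l is a walk from x to y.

data IsWalk (G : Graph) : V G → V G → List (V G) → Set where
  single : ∀ x → IsWalk G x x (x ∷ [])
  step   : ∀ {x y z l} → E G x y → IsWalk G y z l → IsWalk G x z (x ∷ l)

Connected : Graph → Set
Connected G = ∀ x y → Σ (List (V G)) (IsWalk G x y)

CW : (G : Graph) → V G → Set
CW G v = Σ (List (V G)) (IsWalk G v v)

trivialCW : (G : Graph) (v : V G) → CW G v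
trivialCW G v = (v ∷ [] , single v)

InsStep : (G : Graph) → List (V G) → List (V G) → Set
InsStep G l l' = Σ (List (V G)) λ as → Σ (V G) λ x → Σ (V G) λ y →
  Σ (List (V G)) λ bs →
  (l ≡ as ++ (x ∷ bs)) × (l' ≡ as ++ (x ∷ y ∷ x ∷ bs)) × E G x y

OneStep : (G : Graph) → List (V G) → List (V G) → Set
OneStep G l l' = Σ (List (V G)) λ as → Σ (V G) λ a → Σ (V G) λ b →
  Σ (List (V G)) λ bs →
  (l ≡ as ++ (a ∷ bs)) × (l' ≡ as ++ (b ∷ bs))

Step2 : (G : Graph) (v : V G) → CW G v → CW G v → Set
Step2 G v c c' = InsStep G (proj₁ c) (proj₁ c') ⊎ OneStep G (proj₁ c) (proj₁ c')

-- the equivalence generated by (A) and (B) on closed walks at v;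
-- π₁²(G,v) is the quotient of CW G v by this relation.
Equiv2 : (G : Graph) (v : V G) → CW G v → CW G v → Set
Equiv2 G v = EqClosure (Step2 G v)

N2 : (G : Graph) → V G → V G → Set
N2 G x y = Σ (V G) λ z → E G x z × E G z y

record Universal2Covering (G : Graph) (v : V G) : Set₁ where
  field
    Cov    : Graph
    base   : V Cov
    p      : V Cov → V G
    p-hom  : ∀ {x y} → E Cov x y → E G (p x) (p y)
    p-base : p base ≡ v
    N-inj  : ∀ x y z → E Cov x y → E Cov x z → p y ≡ p z → y ≡ z
    N-surj : ∀ x z → E G (p x) z → Σ (V Cov) λ y → E Cov x y × p y ≡ z
    N2-inj  : ∀ x y z → N2 Cov x y → N2 Cov x z → p y ≡ p z → y ≡ z
    N2-surj : ∀ x z → N2 G (p x) z → Σ (V Cov) λ y → N2 Cov x y × p y ≡ z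
    connected : Connected Cov
    simply    : ∀ (c : CW Cov base) → Equiv2 Cov base c (trivialCW Cov base)
open Universal2Covering public

-- Action of [γ] ∈ π₁²(G,v) (γ a closed walk at v, given as its vertex
-- list) on the universal 2-covering:  Act C γ y z  means  z = [γ]·y,
-- i.e. z is the endpoint of the lift from the base point of γ·(p∘φ)
-- for some walk φ from the base point to y.
Act : {G : Graph} {v : V G} (C : Universal2Covering G v) →
      List (V G) → V (Cov C) → V (Cov C) → Set
Act {G} C γ y z =
  Σ (List (V (Cov C))) λ φ → IsWalk (Cov C) (base C) y φ ×
  Σ (List (V (Cov C))) λ ψ → IsWalk (Cov C) (base C) z ψ ×
  (map (p C) ψ ≡ γ ++ drop 1 (map (p C) φ))

-- Γ-equivariant multi-homomorphisms  G̃ → H̃,  Γ = π₁²(G,v) acting on H̃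
-- through f_* ([γ] ↦ [f∘γ]).

module _ {G H : Graph} {v : V G} (f : Hom G H)
         (CG : Universal2Covering G v)
         (CH : Universal2Covering H (fun f v)) where

  MultiMap : Set₁
  MultiMap = V (Cov CG) → V (Cov CH) → Set

  record IsEqMultiHom (η : MultiMap) : Set where
    field
      nonempty : ∀ x → Σ (V (Cov CH)) (η x)
      edges    : ∀ {x y a b} → E (Cov CG) x y → η x a → η y b → E (Cov CH) a b
      equiv₁   : ∀ (γ : CW G v) x x' → Act CG (proj₁ γ) x x' →
                 ∀ z → η x' z → Σ (V (Cov CH)) λ y → η x y × Act CH (map (fun f) (proj₁ γ)) y z
      equiv₂   : ∀ (γ : CW G v) x x' → Act CG (proj₁ γ) x x' →
                 ∀ z → Σ (V (Cov CH)) (λ y → η x y × Act CH (map (fun f) (proj₁ γ)) y z) → η x' z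

  EqMultiHom : Set₁
  EqMultiHom = Σ MultiMap IsEqMultiHom

  _⊑_ : EqMultiHom → EqMultiHom → Set
  m ⊑ m' = ∀ x y → proj₁ m x y → proj₁ m' x y

  -- same connected component of the order complex of Hom^Γ(G̃,H̃):
  -- connected by a zigzag of comparable elements
  SameComponent : EqMultiHom → EqMultiHom → Set₁
  SameComponent = Star (λ m m' → (m ⊑ m') ⊎ (m' ⊑ m))

  -- graph homomorphisms as singleton-valued multi-homomorphisms
  sing : (V (Cov CG) → V (Cov CH)) → MultiMap
  sing F x y = y ≡ F x

-- adjacency in I_n (restricted to 0..n by the side conditions below)
NearI : ℕ → ℕ → Set
NearI i j = (i ≡ j) ⊎ (suc i ≡ j) ⊎ (i ≡ suc j)

record TimesHomotopy {G H : Graph} (f : Hom G H) (n : ℕ) : Set where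
  field
    h     : V G → ℕ → V H
    hom   : ∀ {x x' i j} → i ≤ n → j ≤ n → E G x x' → NearI i j →
            E H (h x i) (h x' j)
    start : ∀ x → h x 0 ≡ fun f x
    end   : ∀ x → h x n ≡ fun f x
open TimesHomotopy public

realizedWalk : {G H : Graph} {f : Hom G H} {n : ℕ} →
               TimesHomotopy f n → V G → V G → List (V H)
realizedWalk {n = n} T v v' =
  concatMap (λ i → h T v i ∷ h T v' i ∷ []) (upTo n) ++ (h T v n ∷ [])

-- ϖ ∈ Π(f,v)   (ϖ given by a representative closed walk at f(v))
InPi : {G H : Graph} (f : Hom G H) (v : V G) → CW H (fun f v) → Set
InPi {G} {H} f v ϖ =
  Σ ℕ λ n → Σ (TimesHomotopy f n) λ T → Σ (V G) λ v' → E G v v' ×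
  Σ (IsWalk H (fun f v) (fun f v) (realizedWalk T v v')) λ w →
  Equiv2 H (fun f v) (realizedWalk T v v' , w) ϖ

module Submission where

open import Defs
open import Data.Product using (Σ; _×_; _,_; proj₁)
open import Function.Bundles using (_⇔_)
open import Relation.Binary.PropositionalEquality using (_≡_)

open import Data.Empty using (⊥; ⊥-elim)
open import Data.List using (List; []; _∷_; _++_; _∷ʳ_; map; drop; concatMap; upTo; reverse)
open import Data.List.Properties
  using (map-++; ++-assoc; ++-identityʳ; map-∘; map-cong; drop-map; concatMap-map; map-upTo; unfold-reverse; reverse-involutive; reverse-map; ∷-injectiveˡ; ∷-injectiveʳ)
open import Data.Nat using (ℕ; zero; suc; _≤_; _<_; _⊓_; s≤s; z≤n)
open import Data.Nat.Properties using (m⊓n≤n; ⊓-idem; m≤n⇒m⊓n≡m; suc-injective; ⊓-zeroʳ; <⇒≤)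
open import Relation.Nullary using (¬_)
open import Data.Product using (proj₂)
open import Data.Sum using (_⊎_; inj₁; inj₂; swap)
open import Function.Base using (_∘_)
open import Function.Bundles using (mk⇔)
open import Relation.Binary.PropositionalEquality using (refl; trans; cong; cong₂; subst; subst₂)
import Relation.Binary.PropositionalEquality as ≡
open import Relation.Binary.Construct.Closure.Equivalence using (EqClosure; gmap)
import Relation.Binary.Construct.Closure.Equivalence as EqClosure
import Relation.Binary.Construct.Closure.ReflexiveTransitive as Star
open import Relation.Binary.Construct.Closure.ReflexiveTransitive using (Star; ε; _◅_; _◅◅_)
open import Relation.Binary.Construct.Closure.Symmetric using (fwd; bwd)

-- ⇒: a ×-homotopy h from f to f is lifted level by level to maps h̃ᵢ : G̃ → H̃ starting at f̃,
-- h̃ᵢ₊₁(x) being the unique vertex of N²(h̃ᵢ x) over hᵢ₊₁(p x); the h̃ᵢ are equivariant homomorphisms,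
-- consecutive ones lie below their union, and the lift of the realized walk shows h̃ₙ = ϖ f̃.
-- ⇐: along a zigzag of comparable equivariant multi-homomorphisms from ϖ f̃ to f̃, choosing values over a
-- section of p_G gives maps G → H forming a ×-homotopy from f to f, and any two lifts from the base point
-- of homotopic walks end at the same vertex, so the walk it realizes represents ϖ.

infixr 5 _++′_

-- Concatenation of vertex sequences sharing the junction vertex, as in the definition of Act.
_++′_ : {A : Set} → List A → List A → List A
l ++′ r = l ++ drop 1 r

map-++′ : {A B : Set} (g : A → B) (l r : List A) → map g (l ++′ r) ≡ map g l ++′ map g r
map-++′ g l r = trans (map-++ g l (drop 1 r)) (cong (map g l ++_) (≡.sym (drop-map 1 r)))

snoc-view : {A : Set} (c : A) (as : List A) → Σ (List A) λ as₀ → Σ A λ u → c ∷ as ≡ as₀ ∷ʳ u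
snoc-view c [] = [] , c , refl
snoc-view c (d ∷ as) with snoc-view d as
... | as₀ , u , eq = c ∷ as₀ , u , cong (c ∷_) eq

zigzag : {A : Set} → (ℕ → A) → (ℕ → A) → ℕ → List A
zigzag g g' zero    = g 0 ∷ []
zigzag g g' (suc n) = g 0 ∷ g' 0 ∷ zigzag (g ∘ suc) (g' ∘ suc) n

realizedWalk≡zigzag : {G H : Graph} {f : Hom G H} {n : ℕ} (T : TimesHomotopy f n) (v v' : V G) →
                      realizedWalk T v v' ≡ zigzag (h T v) (h T v') n
realizedWalk≡zigzag {n = n} T v v' = go (h T v) (h T v') n
  where
    go : ∀ {A : Set} (g g' : ℕ → A) (n : ℕ) →
         concatMap (λ i → g i ∷ g' i ∷ []) (upTo n) ++ g n ∷ [] ≡ zigzag g g' n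
    go g g' zero    = refl
    go g g' (suc n) = cong (λ l → g 0 ∷ g' 0 ∷ l) (trans
      (cong (λ l → concatMap (λ i → g i ∷ g' i ∷ []) l ++ g (suc n) ∷ []) (≡.sym (map-upTo suc n)))
      (trans (cong (_++ g (suc n) ∷ []) (concatMap-map (λ i → g i ∷ g' i ∷ []) suc (upTo n)))
             (go (g ∘ suc) (g' ∘ suc) n)))

map-zigzag : {A B : Set} (q : A → B) (g g' : ℕ → A) (n : ℕ) → map q (zigzag g g' n) ≡ zigzag (q ∘ g) (q ∘ g') n
map-zigzag q g g' zero    = refl
map-zigzag q g g' (suc n) = cong (λ l → q (g 0) ∷ q (g' 0) ∷ l) (map-zigzag q (g ∘ suc) (g' ∘ suc) n)

zigzag-cong : {A : Set} {g g' k k' : ℕ → A} (n : ℕ) → (∀ i → i ≤ n → g i ≡ k i) → (∀ i → i < n → g' i ≡ k' i) →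
              zigzag g g' n ≡ zigzag k k' n
zigzag-cong zero    eq eq' = cong (_∷ []) (eq 0 z≤n)
zigzag-cong (suc n) eq eq' = cong₂ _∷_ (eq 0 z≤n) (cong₂ _∷_ (eq' 0 (s≤s z≤n))
  (zigzag-cong n (λ i i≤n → eq (suc i) (s≤s i≤n)) (λ i i<n → eq' (suc i) (s≤s i<n))))

Walk : (G : Graph) → V G → V G → Set
Walk G x y = Σ (List (V G)) (IsWalk G x y)

Move : (G : Graph) → List (V G) → List (V G) → Set
Move G l l' = InsStep G l l' ⊎ OneStep G l l'

-- Homotopy of walks with fixed ends; on closed walks at v it is Equiv2 G v.
Homotopic : (G : Graph) {x y : V G} → Walk G x y → Walk G x y → Set
Homotopic G = EqClosure (λ c c' → Move G (proj₁ c) (proj₁ c'))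

syntax Homotopic G c c' = c ≃[ G ] c'

module _ {G : Graph} where

  retarget : ∀ {s s' t t' l} → s ≡ s' → t ≡ t' → IsWalk G s t l → IsWalk G s' t' l
  retarget refl refl w = w

  walk-head : ∀ {s t l} → IsWalk G s t l → l ≡ s ∷ drop 1 l
  walk-head (single x) = refl
  walk-head (step e w) = refl

  start≡head : ∀ {s t x l} → IsWalk G s t (x ∷ l) → s ≡ x
  start≡head (single _) = refl
  start≡head (step _ _) = refl

  end-unique : ∀ {s s' t t' l} → IsWalk G s t l → IsWalk G s' t' l → t ≡ t'
  end-unique (single x)   (single .x)  = refl
  end-unique (single x)   (step e ())
  end-unique (step e ())  (single _)
  end-unique (step e w)   (step e' w') = end-unique w w'

  drop-1-++ : ∀ {s t l} (q : List (V G)) → IsWalk G s t l → drop 1 (l ++ q) ≡ drop 1 l ++ q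
  drop-1-++ q (single _) = refl
  drop-1-++ q (step _ _) = refl

  ++′-assoc : ∀ {y z b} (a c : List (V G)) → IsWalk G y z b → (a ++′ b) ++′ c ≡ a ++′ (b ++′ c)
  ++′-assoc a c w = trans (++-assoc a _ (drop 1 c)) (cong (a ++_) (≡.sym (drop-1-++ (drop 1 c) w)))

  infixl 5 _∷ʳʷ_
  infixr 5 _++ʷ_

  _∷ʳʷ_ : ∀ {s t u l} → IsWalk G s t l → E G t u → IsWalk G s u (l ∷ʳ u)
  single x   ∷ʳʷ e = step e (single _)
  step e′ w  ∷ʳʷ e = step e′ (w ∷ʳʷ e)

  _++ʷ_ : ∀ {x y z l r} → IsWalk G x y l → IsWalk G y z r → IsWalk G x z (l ++′ r)
  single x ++ʷ single .x = single x
  single x ++ʷ step e w  = step e w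
  step e w ++ʷ w'        = step e (w ++ʷ w')

  reverseʷ : ∀ {x y l} → IsWalk G x y l → IsWalk G y x (reverse l)
  reverseʷ (single x) = single x
  reverseʷ (step {x = x} {l = l} e w) =
    subst (IsWalk G _ _) (≡.sym (unfold-reverse x l)) (reverseʷ w ∷ʳʷ sym G e)

  walk-init : ∀ {x y l} → IsWalk G x y l → Σ (List (V G)) λ l₀ → l ≡ l₀ ∷ʳ y
  walk-init (single x) = [] , refl
  walk-init (step {x = x} e w) with walk-init w
  ... | l₀ , eq = x ∷ l₀ , cong (x ∷_) eq

  split-at : ∀ {s t x} θa {θb} → IsWalk G s t (θa ++ x ∷ θb) →
             IsWalk G s x (θa ∷ʳ x) × IsWalk G x t (x ∷ θb)
  split-at [] (single x) = single x , single x
  split-at [] (step e w) = single _ , step e w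
  split-at (a ∷ []) (step e w) with split-at [] w
  ... | w₁ , w₂ = step e w₁ , w₂
  split-at (a ∷ b ∷ θa) (step e w) with split-at (b ∷ θa) w
  ... | w₁ , w₂ = step e w₁ , w₂

  join-at : ∀ {s t x} θa {θb} → IsWalk G s x (θa ∷ʳ x) → IsWalk G x t (x ∷ θb) →
            IsWalk G s t (θa ++ x ∷ θb)
  join-at [] (single _) w₂ = w₂
  join-at [] (step e ()) w₂
  join-at (a ∷ []) (step e w₁) w₂ = step e (join-at [] w₁ w₂)
  join-at (a ∷ b ∷ θa) (step e w₁) w₂ = step e (join-at (b ∷ θa) w₁ w₂)

  move-prefix : ∀ q {l l'} → Move G l l' → Move G (q ++ l) (q ++ l')
  move-prefix q (inj₁ (as , x , y , bs , refl , refl , e)) =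
    inj₁ (q ++ as , x , y , bs , ≡.sym (++-assoc q as _) , ≡.sym (++-assoc q as _) , e)
  move-prefix q (inj₂ (as , a , b , bs , refl , refl)) =
    inj₂ (q ++ as , a , b , bs , ≡.sym (++-assoc q as _) , ≡.sym (++-assoc q as _))

  move-suffix : ∀ s {l l'} → Move G l l' → Move G (l ++ s) (l' ++ s)
  move-suffix s (inj₁ (as , x , y , bs , refl , refl , e)) =
    inj₁ (as , x , y , bs ++ s , ++-assoc as _ s , ++-assoc as _ s , e)
  move-suffix s (inj₂ (as , a , b , bs , refl , refl)) =
    inj₂ (as , a , b , bs ++ s , ++-assoc as _ s , ++-assoc as _ s)

  ≡⇒≃ : ∀ {x y} (c c' : Walk G x y) → proj₁ c ≡ proj₁ c' → c ≃[ G ] c'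
  ≡⇒≃ (_ , single x) c' refl = fwd (inj₂ ([] , x , x , [] , refl , refl)) ◅ ε
  ≡⇒≃ (_ , step {x = x} {l = l} e w) c' refl = fwd (inj₂ ([] , x , x , l , refl , refl)) ◅ ε

  ≃-sym : ∀ {x y} {c c' : Walk G x y} → c ≃[ G ] c' → c' ≃[ G ] c
  ≃-sym = EqClosure.symmetric _

  ≃-transport : ∀ {a b a' b'} {c c' : Walk G a b} (d d' : Walk G a' b') → a ≡ a' → b ≡ b' →
                proj₁ c ≡ proj₁ d → proj₁ c' ≡ proj₁ d' → c ≃[ G ] c' → d ≃[ G ] d'
  ≃-transport {c = c} {c'} d d' refl refl eq eq' c≃c' =
    ≡⇒≃ d c (≡.sym eq) ◅◅ c≃c' ◅◅ ≡⇒≃ c' d' eq'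

  ≃-prefix : ∀ {x y z pre} (w : IsWalk G x y pre) {c c' : Walk G y z} → c ≃[ G ] c' →
             (pre ++′ proj₁ c , w ++ʷ proj₂ c) ≃[ G ] (pre ++′ proj₁ c' , w ++ʷ proj₂ c')
  ≃-prefix {y = y} w = gmap (λ c → _ , w ++ʷ proj₂ c)
    λ {c} {c'} m → subst₂ (Move G) (as-++ (proj₂ c)) (as-++ (proj₂ c')) (move-prefix (proj₁ (walk-init w)) m)
    where
      as-++ : ∀ {z l} → IsWalk G y z l → proj₁ (walk-init w) ++ l ≡ _ ++′ l
      as-++ {l = l} w' = ≡.sym (trans (cong (_++′ l) (proj₂ (walk-init w)))
        (trans (++-assoc (proj₁ (walk-init w)) (y ∷ []) (drop 1 l))
               (cong (proj₁ (walk-init w) ++_) (≡.sym (walk-head w')))))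

  ≃-suffix : ∀ {x y z r} (w : IsWalk G y z r) {c c' : Walk G x y} → c ≃[ G ] c' →
             (proj₁ c ++′ r , proj₂ c ++ʷ w) ≃[ G ] (proj₁ c' ++′ r , proj₂ c' ++ʷ w)
  ≃-suffix {r = r} w = gmap (λ c → _ , proj₂ c ++ʷ w) (move-suffix (drop 1 r))

  reverse-cancel : ∀ {y z r} (w : IsWalk G y z r) →
                   (reverse r ++′ r , reverseʷ w ++ʷ w) ≃[ G ] (z ∷ [] , single z)
  reverse-cancel (single x) = ≡⇒≃ _ _ refl
  reverse-cancel (step {x = y} {y = y₁} {l = l} e w) = bwd backtrack ◅ reverse-cancel w
    where
      l' = drop 1 l
      l≡ : l ≡ y₁ ∷ l'
      l≡ = walk-head w
      short : reverse l ++′ l ≡ reverse l' ++ y₁ ∷ l'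
      short = begin
        reverse l ++′ l                 ≡⟨ cong (λ m → reverse m ++′ m) l≡ ⟩
        reverse (y₁ ∷ l') ++ l'         ≡⟨ cong (_++ l') (unfold-reverse y₁ l') ⟩
        (reverse l' ∷ʳ y₁) ++ l'        ≡⟨ ++-assoc (reverse l') (y₁ ∷ []) l' ⟩
        reverse l' ++ y₁ ∷ l'           ∎
        where open ≡.≡-Reasoning
      long : reverse (y ∷ l) ++′ (y ∷ l) ≡ reverse l' ++ y₁ ∷ y ∷ y₁ ∷ l'
      long = begin
        reverse (y ∷ l) ++ l                        ≡⟨ cong (_++ l) (unfold-reverse y l) ⟩
        (reverse l ∷ʳ y) ++ l                       ≡⟨ cong (λ m → (reverse m ∷ʳ y) ++ m) l≡ ⟩
        (reverse (y₁ ∷ l') ∷ʳ y) ++ y₁ ∷ l'         ≡⟨ cong (λ m → (m ∷ʳ y) ++ y₁ ∷ l') (unfold-reverse y₁ l') ⟩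
        ((reverse l' ∷ʳ y₁) ∷ʳ y) ++ y₁ ∷ l'        ≡⟨ ++-assoc (reverse l' ∷ʳ y₁) (y ∷ []) (y₁ ∷ l') ⟩
        (reverse l' ∷ʳ y₁) ++ y ∷ y₁ ∷ l'           ≡⟨ ++-assoc (reverse l') (y₁ ∷ []) (y ∷ y₁ ∷ l') ⟩
        reverse l' ++ y₁ ∷ y ∷ y₁ ∷ l'              ∎
        where open ≡.≡-Reasoning
      backtrack : Move G (reverse l ++′ l) (reverse (y ∷ l) ++′ (y ∷ l))
      backtrack = inj₁ (reverse l' , y₁ , y , l' , short , long , sym G e)

zigzagʷ : ∀ {G : Graph} (g g' : ℕ → V G) → (∀ i → E G (g i) (g' i)) → (∀ i → E G (g' i) (g (suc i))) →
          ∀ n → IsWalk G (g 0) (g n) (zigzag g g' n)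
zigzagʷ g g' e e' zero    = single _
zigzagʷ g g' e e' (suc n) = step (e 0) (step (e' 0) (zigzagʷ (g ∘ suc) (g' ∘ suc) (e ∘ suc) (e' ∘ suc) n))

module _ {G H : Graph} (φ : V G → V H) (φ-edge : ∀ {x y} → E G x y → E H (φ x) (φ y)) where

  mapʷ : ∀ {x y l} → IsWalk G x y l → IsWalk H (φ x) (φ y) (map φ l)
  mapʷ (single x) = single (φ x)
  mapʷ (step e w) = step (φ-edge e) (mapʷ w)

  move-map : ∀ {l l'} → Move G l l' → Move H (map φ l) (map φ l')
  move-map (inj₁ (as , x , y , bs , refl , refl , e)) =
    inj₁ (map φ as , φ x , φ y , map φ bs , map-++ φ as _ , map-++ φ as _ , φ-edge e)
  move-map (inj₂ (as , a , b , bs , refl , refl)) =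
    inj₂ (map φ as , φ a , φ b , map φ bs , map-++ φ as _ , map-++ φ as _)

  ≃-map : ∀ {x y} {c c' : Walk G x y} → c ≃[ G ] c' →
          (map φ (proj₁ c) , mapʷ (proj₂ c)) ≃[ H ] (map φ (proj₁ c') , mapʷ (proj₂ c'))
  ≃-map = gmap (λ c → map φ (proj₁ c) , mapʷ (proj₂ c)) move-map

module Covering {G : Graph} {v : V G} (C : Universal2Covering G v) where

  private
    X = Cov C
    P = p C

  project : ∀ {x y l} → IsWalk X x y l → IsWalk G (P x) (P y) (map P l)
  project = mapʷ P (p-hom C)

  Over : List (V G) → V X → V X → Set
  Over l s t = Σ (List (V X)) λ θ → IsWalk X s t θ × map P θ ≡ l

  lift : ∀ {a b l} → IsWalk G a b l → ∀ s → P s ≡ a → Σ (V X) (Over l s)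
  lift (single a) s refl = s , s ∷ [] , single s , refl
  lift (step {y = a₁} e w) s refl with N-surj C s a₁ e
  ... | y , ey , refl with lift w y refl
  ... | t , θ , wθ , refl = t , s ∷ θ , step ey wθ , refl

  private
    over-nonempty : ∀ {a b θ} → IsWalk X a b θ → map P θ ≡ [] → ⊥
    over-nonempty (single x) ()
    over-nonempty (step e w) ()

    head-over : ∀ {y t θ y' t' θ'} → IsWalk X y t θ → IsWalk X y' t' θ' → map P θ ≡ map P θ' → P y ≡ P y'
    head-over (single _) (single _) eq = ∷-injectiveˡ eq
    head-over (single _) (step _ _) eq = ∷-injectiveˡ eq
    head-over (step _ _) (single _) eq = ∷-injectiveˡ eq
    head-over (step _ _) (step _ _) eq = ∷-injectiveˡ eq

  lift-unique : ∀ {s t θ t' θ'} → IsWalk X s t θ → IsWalk X s t' θ' → map P θ ≡ map P θ' → t ≡ t'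
  lift-unique (single _) (single _) eq = refl
  lift-unique (single _) (step e w) eq = ⊥-elim (over-nonempty w (≡.sym (∷-injectiveʳ eq)))
  lift-unique (step e w) (single _) eq = ⊥-elim (over-nonempty w (∷-injectiveʳ eq))
  lift-unique {s = s} (step {y = y} e w) (step {y = y'} e' w') eq
    with N-inj C s y y' e e' (head-over w w' (∷-injectiveʳ eq))
  ... | refl = lift-unique w w' (∷-injectiveʳ eq)

  private
    map-split : ∀ θ as x bs → map P θ ≡ as ++ x ∷ bs →
                Σ (List (V X)) λ θa → Σ (V X) λ x̃ → Σ (List (V X)) λ θb →
                (θ ≡ θa ++ x̃ ∷ θb) × (map P θa ≡ as) × (P x̃ ≡ x) × (map P θb ≡ bs)
    map-split [] [] x bs ()
    map-split [] (_ ∷ _) x bs ()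
    map-split (y ∷ θ) [] x bs eq = [] , y , θ , refl , refl , ∷-injectiveˡ eq , ∷-injectiveʳ eq
    map-split (y ∷ θ) (a ∷ as) x bs eq with map-split θ as x bs (∷-injectiveʳ eq)
    ... | θa , x̃ , θb , e₁ , e₂ , e₃ , e₄ =
      y ∷ θa , x̃ , θb , cong (y ∷_) e₁ , cong₂ _∷_ (∷-injectiveˡ eq) e₂ , e₃ , e₄

    over-cong : ∀ {l l' s t} → l ≡ l' → Over l s t → Over l' s t
    over-cong refl o = o

    over-insert : ∀ {l l' s t} → InsStep G l l' → Over l s t → Over l' s t
    over-insert (as , x , y , bs , refl , refl , e) (θ , w , m) with map-split θ as x bs m
    ... | θa , x̃ , θb , refl , refl , refl , refl with split-at θa w
    ... | w₁ , w₂ with N-surj C x̃ y e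
    ... | ỹ , ex , refl =
      θa ++ x̃ ∷ ỹ ∷ x̃ ∷ θb , join-at θa w₁ (step ex (step (sym X ex) w₂)) , map-++ P θa _

    -- Two neighbours of ỹ over the same vertex coincide, so the backtrack ỹ x̃ ỹ lies in the lift.
    over-uninsert : ∀ {l l' s t} → InsStep G l' l → Over l s t → Over l' s t
    over-uninsert (as , x , y , bs , refl , refl , e) (θ , w , m) with map-split θ as x (y ∷ x ∷ bs) m
    ... | θa , x̃ , [] , refl , ma , px , ()
    ... | θa , x̃ , _ ∷ [] , refl , ma , px , ()
    ... | θa , x̃ , ỹ ∷ x̃' ∷ θc , refl , refl , refl , mb with split-at θa w
    ... | w₁ , step e₁ (step e₂ w₃)
      with N-inj C ỹ x̃ x̃' (sym X e₁) (subst (E X ỹ) (start≡head w₃) e₂)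
                            (≡.sym (∷-injectiveˡ (∷-injectiveʳ mb)))
    ... | refl =
      θa ++ x̃ ∷ θc , join-at θa w₁ (retarget (start≡head w₃) refl w₃) ,
      trans (map-++ P θa _) (cong (λ q → map P θa ++ P x̃ ∷ q) (∷-injectiveʳ (∷-injectiveʳ mb)))

    -- Replacing an inner vertex: both versions are N²-neighbours of the preceding vertex, with
    -- the same image, so N2-inj identifies the lifts of the following vertex.
    over-replace-inner : ∀ {a₀ b₀ s t} as u a b u' bs → IsWalk G a₀ b₀ (as ++ u ∷ b ∷ u' ∷ bs) →
                         Over (as ++ u ∷ a ∷ u' ∷ bs) s t → Over (as ++ u ∷ b ∷ u' ∷ bs) s t
    over-replace-inner as u a b u' bs wl' (θ , w , m) with map-split θ as u (a ∷ u' ∷ bs) m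
    ... | θa , ũ , [] , refl , ma , pu , ()
    ... | θa , ũ , _ ∷ [] , refl , ma , pu , ()
    ... | θa , ũ , ã ∷ ũ' ∷ θc , refl , refl , refl , mb with split-at θa w | split-at as wl'
    ... | w₁ , step e₁ (step e₂ w₃) | _ , step g₁ (step g₂ w₄) with N-surj C ũ b g₁
    ... | b̃ , eb , refl with N-surj C b̃ u' (subst (E G (P b̃)) (start≡head w₄) g₂)
    ... | ũ'' , eb₂ , pu''
      with N2-inj C ũ ũ' ũ'' (ã , e₁ , subst (E X ã) (start≡head w₃) e₂) (b̃ , eb , eb₂)
                               (trans (∷-injectiveˡ (∷-injectiveʳ mb)) (≡.sym pu''))
    ... | refl =
      θa ++ ũ ∷ b̃ ∷ ũ' ∷ θc , join-at θa w₁ (step eb (step eb₂ (retarget (start≡head w₃) refl w₃))) ,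
      trans (map-++ P θa _) (cong (λ q → map P θa ++ P ũ ∷ P b̃ ∷ q) (∷-injectiveʳ mb))

    last≡end : ∀ {a₀ b₀} as {x} → IsWalk G a₀ b₀ (as ∷ʳ x) → x ≡ b₀
    last≡end as w with split-at as w
    ... | _ , single _ = refl

    over-one-step : ∀ {a₀ b₀ l l' s t} → OneStep G l l' → IsWalk G a₀ b₀ l → IsWalk G a₀ b₀ l' →
                    Over l s t → Over l' s t
    over-one-step ([] , a , b , bs , refl , refl) wl wl' =
      over-cong (cong (_∷ bs) (trans (≡.sym (start≡head wl)) (start≡head wl')))
    over-one-step (c ∷ as , a , b , [] , refl , refl) wl wl' =
      over-cong (cong ((c ∷ as) ∷ʳ_) (trans (last≡end (c ∷ as) wl) (≡.sym (last≡end (c ∷ as) wl'))))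
    over-one-step (c ∷ as , a , b , u' ∷ bs , refl , refl) wl wl' o with snoc-view c as
    ... | as₀ , u , eq =
      over-cong (≡.sym (regroup b))
        (over-replace-inner as₀ u a b u' bs (subst (IsWalk G _ _) (regroup b) wl') (over-cong (regroup a) o))
      where
        regroup : ∀ z → (c ∷ as) ++ z ∷ u' ∷ bs ≡ as₀ ++ u ∷ z ∷ u' ∷ bs
        regroup z = trans (cong (_++ z ∷ u' ∷ bs) eq) (++-assoc as₀ (u ∷ []) (z ∷ u' ∷ bs))

    one-step-sym : ∀ {l l'} → OneStep G l l' → OneStep G l' l
    one-step-sym (as , a , b , bs , e₁ , e₂) = as , b , a , bs , e₂ , e₁

  over-≃ : ∀ {a b} {c c' : Walk G a b} {s t} → c ≃[ G ] c' → Over (proj₁ c) s t → Over (proj₁ c') s t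
  over-≃ ε o = o
  over-≃ (fwd (inj₁ m) ◅ rest) o = over-≃ rest (over-insert m o)
  over-≃ (_◅_ {i = c} {j = c'} (fwd (inj₂ m)) rest) o =
    over-≃ rest (over-one-step m (proj₂ c) (proj₂ c') o)
  over-≃ (bwd (inj₁ m) ◅ rest) o = over-≃ rest (over-uninsert m o)
  over-≃ (_◅_ {i = c} {j = c'} (bwd (inj₂ m)) rest) o =
    over-≃ rest (over-one-step (one-step-sym m) (proj₂ c) (proj₂ c') o)

  fibre-inhabited : Connected G → ∀ x → Σ (V X) λ x̃ → P x̃ ≡ x
  fibre-inhabited cG x with lift (proj₂ (cG v x)) (base C) (p-base C)
  ... | x̃ , θ , wθ , m = x̃ , end-unique (subst (IsWalk G _ _) m (project wθ)) (proj₂ (cG v x))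

  private
    B = base C

  projections-≃ : ∀ {t θ₁ θ₂} (w₁ : IsWalk X B t θ₁) (w₂ : IsWalk X B t θ₂) →
                  (map P θ₁ , project w₁) ≃[ G ] (map P θ₂ , project w₂)
  projections-≃ {t} {θ₁} {θ₂} w₁ w₂ =
    ≃-sym (≃-transport (_ , u₁ ++ʷ (reverseʷ u₂ ++ʷ u₂)) (l₁ , u₁) refl refl refl (++-identityʳ l₁)
                         (≃-prefix u₁ (reverse-cancel u₂)))
    ◅◅ ≡⇒≃ {G = G} _ (_ , (u₁ ++ʷ reverseʷ u₂) ++ʷ u₂) (≡.sym (++′-assoc l₁ l₂ (reverseʷ u₂)))
    ◅◅ ≃-transport _ (l₂ , u₂) refl refl refl (≡.sym (walk-head u₂)) (≃-suffix u₂ loop≃trivial)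
    where
      l₁ = map P θ₁
      l₂ = map P θ₂
      u₁ = project w₁
      u₂ = project w₂
      loop≃trivial : (l₁ ++′ reverse l₂ , u₁ ++ʷ reverseʷ u₂) ≃[ G ] (P B ∷ [] , single _)
      loop≃trivial = ≃-transport _ _ refl refl
        (trans (map-++′ P θ₁ (reverse θ₂)) (cong (l₁ ++′_) (reverse-map P θ₂))) refl
        (≃-map P (p-hom C) (simply C (_ , w₁ ++ʷ reverseʷ w₂)))

  module _ {γ : List (V G)} (wγ : IsWalk G v v γ) where

    private
      over-γ : ∀ {y α} → IsWalk X B y α → IsWalk G v (P y) (γ ++′ map P α)
      over-γ wα = wγ ++ʷ retarget (p-base C) refl (project wα)

    act-fibre : ∀ {y z} → Act C γ y z → P z ≡ P y
    act-fibre (α , wα , ψ , wψ , m) = end-unique (subst (IsWalk G _ _) m (project wψ)) (over-γ wα)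

    act-exists : ∀ y → Σ (V X) (Act C γ y)
    act-exists y with connected C B y
    ... | α , wα with lift (over-γ wα) B (p-base C)
    ... | z , ψ , wψ , m = z , α , wα , ψ , wψ , m

    act-unique : ∀ {y z₁ z₂} → Act C γ y z₁ → Act C γ y z₂ → z₁ ≡ z₂
    act-unique (α₁ , wα₁ , ψ₁ , wψ₁ , m₁) (α₂ , wα₂ , ψ₂ , wψ₂ , m₂)
      with over-≃ (≃-prefix (retarget refl (≡.sym (p-base C)) wγ) (projections-≃ wα₁ wα₂)) (ψ₁ , wψ₁ , m₁)
    ... | ψ , wψ , m = lift-unique wψ wψ₂ (trans m (≡.sym m₂))

    act-edge : ∀ {y y' z z'} → E X y y' → Act C γ y z → Act C γ y' z' → E X z z'
    act-edge {y} {y'} {z} e a@(α , wα , ψ , wψ , m) a'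
      with N-surj C z (P y') (subst (λ q → E G q (P y')) (≡.sym (act-fibre a)) (p-hom C e))
    ... | z'' , ez , pz'' = subst (E X z) (act-unique a'' a') ez
      where
        a'' : Act C γ y' z''
        a'' = α ∷ʳ y' , wα ∷ʳʷ e , ψ ∷ʳ z'' , wψ ∷ʳʷ ez , (begin
          map P (ψ ∷ʳ z'')                     ≡⟨ map-++ P ψ (z'' ∷ []) ⟩
          map P ψ ∷ʳ P z''                     ≡⟨ cong₂ _∷ʳ_ m pz'' ⟩
          (γ ++′ map P α) ∷ʳ P y'              ≡⟨ ++-assoc γ (drop 1 (map P α)) (P y' ∷ []) ⟩
          γ ++ (drop 1 (map P α) ∷ʳ P y')      ≡⟨ cong (γ ++_) (≡.sym (drop-1-++ (P y' ∷ []) (project wα))) ⟩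
          γ ++′ (map P α ∷ʳ P y')              ≡⟨ cong (γ ++′_) (≡.sym (map-++ P α (y' ∷ []))) ⟩
          γ ++′ map P (α ∷ʳ y')                ∎)
          where open ≡.≡-Reasoning

    act-base-≃ : ∀ {z θ} → Act C γ B z → IsWalk X B z θ → (c : Walk G v v) → proj₁ c ≡ map P θ → c ≃[ G ] (γ , wγ)
    act-base-≃ a@(α , wα , ψ , wψ , m) wθ c eq =
      ≃-transport c (_ , w₁) (p-base C) (trans (act-fibre a) (p-base C)) (≡.sym eq) m (projections-≃ wθ wψ)
      ◅◅ ≃-transport (_ , w₁) (γ , wγ) refl (p-base C) refl (++-identityʳ γ)
           (≃-prefix (retarget refl (≡.sym (p-base C)) wγ) (projections-≃ wα (single B)))
      where
        w₁ : IsWalk G v v (γ ++′ map P α)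
        w₁ = wγ ++ʷ retarget (p-base C) (p-base C) (project wα)

  -- γ goes to y' and comes back along the projection of a walk to y, which lifts from y' to the base point.
  act-transitive : ∀ {y y'} → P y ≡ P y' → Σ (CW G v) λ γ → Act C (proj₁ γ) y y'
  act-transitive {y} {y'} eq with connected C B y' | connected C B y
  ... | φ , wφ | α , wα with lift (reverseʷ (project wα)) y' (≡.sym eq)
  ... | t , ρ , wρ , mρ =
    (map P φ ++′ reverse (map P α) ,
     retarget (p-base C) (p-base C) (project wφ ++ʷ retarget eq refl (reverseʷ (project wα)))) ,
    α , wα , φ ++′ (ρ ++′ reverse ρ) , wφ ++ʷ (wρ ++ʷ reverseʷ wρ) , (begin
      map P (φ ++′ (ρ ++′ reverse ρ))                        ≡⟨ map-++′ P φ (ρ ++′ reverse ρ) ⟩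
      map P φ ++′ map P (ρ ++′ reverse ρ)                    ≡⟨ cong (map P φ ++′_) (map-++′ P ρ (reverse ρ)) ⟩
      map P φ ++′ (map P ρ ++′ map P (reverse ρ))            ≡⟨ cong (λ q → map P φ ++′ (map P ρ ++′ q)) (reverse-map P ρ) ⟩
      map P φ ++′ (map P ρ ++′ reverse (map P ρ))            ≡⟨ cong (λ q → map P φ ++′ (q ++′ reverse q)) mρ ⟩
      map P φ ++′ (reverse pα ++′ reverse (reverse pα))      ≡⟨ cong (λ q → map P φ ++′ (reverse pα ++′ q)) (reverse-involutive pα) ⟩
      map P φ ++′ (reverse pα ++′ pα)                        ≡⟨ ≡.sym (++′-assoc (map P φ) pα (reverseʷ (project wα))) ⟩
      (map P φ ++′ reverse pα) ++′ pα                        ∎)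
    where
      pα = map P α
      open ≡.≡-Reasoning

neighbour : {G : Graph} → Connected G → HasEdge G → ∀ x → Σ (V G) (E G x)
neighbour cG (a , b , eab) x with cG x a
... | _ , single _ = b , eab
... | _ , step e _ = _ , e

Adjacent : (G H : Graph) → (V G → V H) → (V G → V H) → Set
Adjacent G H g g' = ∀ {x x'} → E G x x' → E H (g x) (g' x')

IsXPath : (G H : Graph) → ℕ → (V G → ℕ → V H) → Set
IsXPath G H n hh = ∀ {x x' i j} → i ≤ n → j ≤ n → E G x x' → NearI i j → E H (hh x i) (hh x' j)

prepend : {A B : Set} → (A → B) → (A → ℕ → B) → A → ℕ → B
prepend g hh x zero    = g x
prepend g hh x (suc i) = hh x i

private
  suc⊓-cases : ∀ i n → (suc i ⊓ n ≡ suc (i ⊓ n)) ⊎ (suc i ⊓ n ≡ i ⊓ n)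
  suc⊓-cases i zero = inj₂ (≡.sym (⊓-zeroʳ i))
  suc⊓-cases zero (suc n) = inj₁ refl
  suc⊓-cases (suc i) (suc n) with suc⊓-cases i n
  ... | inj₁ q = inj₁ (cong suc q)
  ... | inj₂ q = inj₂ (cong suc q)

  NearI-pred : ∀ {i j} → NearI (suc i) (suc j) → NearI i j
  NearI-pred (inj₁ q)        = inj₁ (suc-injective q)
  NearI-pred (inj₂ (inj₁ q)) = inj₂ (inj₁ (suc-injective q))
  NearI-pred (inj₂ (inj₂ q)) = inj₂ (inj₂ (suc-injective q))

  ¬NearI-0-2+ : ∀ {j} → ¬ NearI 0 (suc (suc j))
  ¬NearI-0-2+ (inj₁ ())
  ¬NearI-0-2+ (inj₂ (inj₁ ()))
  ¬NearI-0-2+ (inj₂ (inj₂ ()))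

  ¬NearI-2+-0 : ∀ {i} → ¬ NearI (suc (suc i)) 0
  ¬NearI-2+-0 (inj₁ ())
  ¬NearI-2+-0 (inj₂ (inj₁ ()))
  ¬NearI-2+-0 (inj₂ (inj₂ ()))

xpath-prepend : ∀ {G H n g hh} → Adjacent G H g g → Adjacent G H g (λ x → hh x 0) →
                IsXPath G H n hh → IsXPath G H (suc n) (prepend g hh)
xpath-prepend g~g g~h₀ hh-path {i = zero}        {zero}        _ _ e _  = g~g e
xpath-prepend g~g g~h₀ hh-path {i = zero}        {suc zero}    _ _ e _  = g~h₀ e
xpath-prepend g~g g~h₀ hh-path {i = zero}        {suc (suc j)} _ _ e nr = ⊥-elim (¬NearI-0-2+ nr)
xpath-prepend {G} {H} g~g g~h₀ hh-path {i = suc zero} {zero} _ _ e _ = sym H (g~h₀ (sym G e))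
xpath-prepend g~g g~h₀ hh-path {i = suc (suc i)} {zero}        _ _ e nr = ⊥-elim (¬NearI-2+-0 nr)
xpath-prepend g~g g~h₀ hh-path {i = suc i}       {suc j} (s≤s i≤n) (s≤s j≤n) e nr =
  hh-path i≤n j≤n e (NearI-pred nr)

-- Clamping the time at n extends a ×-homotopy to all of ℕ, so that its levels can be built by recursion.
module _ {G H : Graph} {f : Hom G H} {n : ℕ} (T : TimesHomotopy f n) where

  clamped : ℕ → V G → V H
  clamped i x = h T x (i ⊓ n)

  clamped-level : ∀ i → Adjacent G H (clamped i) (clamped i)
  clamped-level i e = hom T (m⊓n≤n i n) (m⊓n≤n i n) e (inj₁ refl)

  clamped-step : ∀ i → Adjacent G H (clamped i) (clamped (suc i))
  clamped-step i e with suc⊓-cases i n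
  ... | inj₁ q = hom T (m⊓n≤n i n) (m⊓n≤n (suc i) n) e (inj₂ (inj₁ (≡.sym q)))
  ... | inj₂ q = hom T (m⊓n≤n i n) (m⊓n≤n (suc i) n) e (inj₁ (≡.sym q))

module Setting {G H : Graph} (cG : Connected G) (eG : HasEdge G) (f : Hom G H) {v : V G}
               (CG : Universal2Covering G v) (CH : Universal2Covering H (fun f v))
               (f̃ : Hom (Cov CG) (Cov CH)) (f̃-base : fun f̃ (base CG) ≡ base CH)
               (f̃-over : ∀ x → p CH (fun f̃ x) ≡ fun f (p CG x)) where

  private
    G̃ = Cov CG
    H̃ = Cov CH
    pG = p CG
    pH = p CH
    ṽ = base CG
    w̃ = base CH
    module CovG = Covering CG
    module CovH = Covering CH

    f-loop : (γ : CW G v) → IsWalk H (fun f v) (fun f v) (map (fun f) (proj₁ γ))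
    f-loop γ = mapʷ (fun f) (pres f) (proj₂ γ)

  Equivariant : (V G̃ → V H̃) → Set
  Equivariant φ = ∀ (γ : CW G v) {x x'} → Act CG (proj₁ γ) x x' → Act CH (map (fun f) (proj₁ γ)) (φ x) (φ x')

  record EquivariantLift (g : V G → V H) : Set where
    field
      φ           : V G̃ → V H̃
      over        : ∀ x → pH (φ x) ≡ g (pG x)
      edge        : Adjacent G̃ H̃ φ φ
      equivariant : Equivariant φ
  open EquivariantLift

  f̃-lift : EquivariantLift (fun f)
  f̃-lift = record { φ = fun f̃ ; over = f̃-over ; edge = pres f̃ ; equivariant = equivariant′ }
    where
      pH∘f̃ : ∀ l → map pH (map (fun f̃) l) ≡ map (fun f) (map pG l)
      pH∘f̃ l = trans (≡.sym (map-∘ l)) (trans (map-cong f̃-over l) (map-∘ l))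
      equivariant′ : Equivariant (fun f̃)
      equivariant′ (γ , _) (α , wα , β , wβ , m) =
        map (fun f̃) α , retarget f̃-base refl (mapʷ (fun f̃) (pres f̃) wα) ,
        map (fun f̃) β , retarget f̃-base refl (mapʷ (fun f̃) (pres f̃) wβ) ,
        trans (pH∘f̃ β) (trans (cong (map (fun f)) m) (trans (map-++′ (fun f) γ (map pG α))
          (cong (map (fun f) γ ++′_) (≡.sym (pH∘f̃ α)))))

  lift-cong : ∀ {g g'} → (∀ x → g x ≡ g' x) → EquivariantLift g → EquivariantLift g'
  lift-cong g≗g' L = record
    { φ = φ L ; over = λ x → trans (over L x) (g≗g' (pG x)) ; edge = edge L ; equivariant = equivariant L }

  private
    EMH : Set₁
    EMH = EqMultiHom f CG CH

    _⊑ₘ_ : EMH → EMH → Set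
    _⊑ₘ_ = _⊑_ f CG CH

  sing-isEqMultiHom : ∀ {φ} → Adjacent G̃ H̃ φ φ → Equivariant φ → IsEqMultiHom f CG CH (sing f CG CH φ)
  sing-isEqMultiHom {φ} φ-edge φ-equiv = record
    { nonempty = λ x → φ x , refl
    ; edges    = λ { e refl refl → φ-edge e }
    ; equiv₁   = λ { γ x x' a _ refl → φ x , refl , φ-equiv γ a }
    ; equiv₂   = λ { γ x x' a z (_ , refl , az) → CovH.act-unique (f-loop γ) az (φ-equiv γ a) }
    }

  singleton : ∀ {g} → EquivariantLift g → EMH
  singleton L = sing f CG CH (φ L) , sing-isEqMultiHom (edge L) (equivariant L)

  -- Two adjacent equivariant lifts lie below their pointwise union, so they are in the same component.
  adjacent-lifts-component : ∀ {g g'} (L : EquivariantLift g) (L' : EquivariantLift g') →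
                             Adjacent G̃ H̃ (φ L) (φ L') → SameComponent f CG CH (singleton L') (singleton L)
  adjacent-lifts-component L L' cross = _◅_ {j = union} (inj₁ (λ _ _ → inj₂)) (inj₂ (λ _ _ → inj₁) ◅ ε)
    where
      union : EMH
      union = (λ x y → y ≡ φ L x ⊎ y ≡ φ L' x) , record
        { nonempty = λ x → φ L x , inj₁ refl
        ; edges    = λ { e (inj₁ refl) (inj₁ refl) → edge L e
                       ; e (inj₁ refl) (inj₂ refl) → cross e
                       ; e (inj₂ refl) (inj₁ refl) → sym H̃ (cross (sym G̃ e))
                       ; e (inj₂ refl) (inj₂ refl) → edge L' e }
        ; equiv₁   = λ { γ x x' a _ (inj₁ refl) → φ L x , inj₁ refl , equivariant L γ a
                       ; γ x x' a _ (inj₂ refl) → φ L' x , inj₂ refl , equivariant L' γ a }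
        ; equiv₂   = λ { γ x x' a z (_ , inj₁ refl , az) → inj₁ (CovH.act-unique (f-loop γ) az (equivariant L γ a))
                       ; γ x x' a z (_ , inj₂ refl , az) → inj₂ (CovH.act-unique (f-loop γ) az (equivariant L' γ a)) }
        }

  private
    neighbourG̃ : ∀ x → Σ (V G̃) (E G̃ x)
    neighbourG̃ x with neighbour cG eG (pG x)
    ... | y , e with N-surj CG x y e
    ... | ỹ , eỹ , _ = ỹ , eỹ

  module LiftStep {g g' : V G → V H} (g~g' : Adjacent G H g g') (g'~g' : Adjacent G H g' g')
                  (L : EquivariantLift g) where

    private
      nextΣ : ∀ x → Σ (V H̃) λ y → N2 H̃ (φ L x) y × pH y ≡ g' (pG x)
      nextΣ x = N2-surj CH (φ L x) (g' (pG x))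
        (g (pG y) , subst (E H _) (over L y) (p-hom CH (edge L ey)) , g~g' (sym G (p-hom CG ey)))
        where
          y = proj₁ (neighbourG̃ x)
          ey = proj₂ (neighbourG̃ x)

    next : V G̃ → V H̃
    next x = proj₁ (nextΣ x)

    next-over : ∀ x → pH (next x) ≡ g' (pG x)
    next-over x = proj₂ (proj₂ (nextΣ x))

    private
      N2-unique-over : ∀ {y t} → N2 H̃ (φ L y) t → pH t ≡ g' (pG y) → t ≡ next y
      N2-unique-over {y} {t} n2 pt =
        N2-inj CH (φ L y) t (next y) n2 (proj₁ (proj₂ (nextΣ y))) (trans pt (≡.sym (next-over y)))

    cross : Adjacent G̃ H̃ (φ L) next
    cross {x} {y} e
      with N-surj CH (φ L x) (g' (pG y)) (subst (λ q → E H q (g' (pG y))) (≡.sym (over L x)) (g~g' (p-hom CG e)))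
    ... | t , et , pt = subst (E H̃ (φ L x)) (N2-unique-over (φ L x , sym H̃ (edge L e) , et) pt) et

    next-edge : Adjacent G̃ H̃ next next
    next-edge {x} {y} e
      with N-surj CH (next x) (g' (pG y)) (subst (λ q → E H q (g' (pG y))) (≡.sym (next-over x)) (g'~g' (p-hom CG e)))
    ... | t , et , pt = subst (E H̃ (next x)) (N2-unique-over (next x , cross (sym G̃ e) , et) pt) et

    -- [γ]·next x is in N²(φ x'), through [γ]·φ y for a neighbour y of x, so it is next x'.
    next-equivariant : Equivariant next
    next-equivariant γ {x} {x'} a = subst (Act CH _ (next x)) (N2-unique-over (q , e₁ , e₂) pz) az
      where
        γ-loop = f-loop γ
        y = proj₁ (neighbourG̃ x)
        ey = proj₂ (neighbourG̃ x)
        z = proj₁ (CovH.act-exists γ-loop (next x))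
        az = proj₂ (CovH.act-exists γ-loop (next x))
        q = proj₁ (CovH.act-exists γ-loop (φ L y))
        aq = proj₂ (CovH.act-exists γ-loop (φ L y))
        e₁ : E H̃ (φ L x') q
        e₁ = CovH.act-edge γ-loop (edge L ey) (equivariant L γ a) aq
        e₂ : E H̃ q z
        e₂ = CovH.act-edge γ-loop (cross (sym G̃ ey)) aq az
        pz : pH z ≡ g' (pG x')
        pz = trans (CovH.act-fibre γ-loop az)
               (trans (next-over x) (cong g' (≡.sym (CovG.act-fibre (proj₂ γ) a))))

    next-lift : EquivariantLift g'
    next-lift = record { φ = next ; over = next-over ; edge = next-edge ; equivariant = next-equivariant }

  act-from-base : (L : EquivariantLift (fun f)) {ϖ : List (V H)} → CovH.Over ϖ w̃ (φ L ṽ) →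
                  ∀ x → Act CH ϖ (fun f̃ x) (φ L x)
  act-from-base L {ϖ} (ψ , wψ , mψ) x =
    map (fun f̃) α , retarget f̃-base refl (mapʷ (fun f̃) (pres f̃) wα) ,
    ψ ++′ map (φ L) α , wψ ++ʷ mapʷ (φ L) (edge L) wα ,
    trans (map-++′ pH ψ (map (φ L) α)) (cong₂ _++′_ mψ (same-projection α))
    where
      α = proj₁ (connected CG ṽ x)
      wα = proj₂ (connected CG ṽ x)
      same-projection : ∀ l → map pH (map (φ L) l) ≡ map pH (map (fun f̃) l)
      same-projection l = trans (≡.sym (map-∘ l))
        (trans (map-cong (λ y → trans (over L y) (≡.sym (f̃-over y))) l) (map-∘ l))

  module Forward {n : ℕ} (T : TimesHomotopy f n) where

    private
      gs : ℕ → V G → V H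
      gs = clamped T

      adjacencies : ∀ i → Adjacent G H (gs i) (gs (suc i)) × Adjacent G H (gs (suc i)) (gs (suc i))
      adjacencies i = clamped-step T i , clamped-level T (suc i)

    level : ∀ i → EquivariantLift (gs i)
    level zero    = lift-cong (λ x → ≡.sym (start T x)) f̃-lift
    level (suc i) = LiftStep.next-lift (proj₁ (adjacencies i)) (proj₂ (adjacencies i)) (level i)

    level-step : ∀ i → Adjacent G̃ H̃ (φ (level i)) (φ (level (suc i)))
    level-step i = LiftStep.cross (proj₁ (adjacencies i)) (proj₂ (adjacencies i)) (level i)

    level-component : ∀ k → SameComponent f CG CH (singleton (level k)) (singleton (level 0))
    level-component zero    = ε
    level-component (suc k) = adjacent-lifts-component (level k) (level (suc k)) (level-step k) ◅◅ level-component k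

    final : EquivariantLift (fun f)
    final = lift-cong (λ x → trans (cong (h T x) (⊓-idem n)) (end T x)) (level n)

    realizedWalk-lifts : ∀ {v'} → E G v v' → CovH.Over (realizedWalk T v v') (fun f̃ ṽ) (φ final ṽ)
    realizedWalk-lifts {v'} ev with N-surj CG ṽ v' (subst (λ q → E G q v') (≡.sym (p-base CG)) ev)
    ... | ṽ' , eṽ' , pṽ' =
      zigzag (λ i → φ (level i) ṽ) (λ i → φ (level i) ṽ') n ,
      zigzagʷ _ _ (λ i → edge (level i) eṽ') (λ i → level-step i (sym G̃ eṽ')) n ,
      trans (map-zigzag pH _ _ n)
        (trans (zigzag-cong n (λ i i≤n → on-level i≤n (p-base CG)) (λ i i<n → on-level (<⇒≤ i<n) pṽ'))
               (≡.sym (realizedWalk≡zigzag T v v')))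
      where
        on-level : ∀ {i y x} → i ≤ n → pG y ≡ x → pH (φ (level i) y) ≡ h T x i
        on-level {i} {y} i≤n refl = trans (over (level i) y) (cong (h T (pG y)) (m≤n⇒m⊓n≡m i≤n))

    realized-act : ∀ {ϖ : CW H (fun f v)} {v' wR} → E G v v' → Equiv2 H (fun f v) (realizedWalk T v v' , wR) ϖ →
                   ∀ x → Act CH (proj₁ ϖ) (fun f̃ x) (φ final x)
    realized-act {ϖ} ev R≃ϖ =
      act-from-base final (subst (λ s → CovH.Over (proj₁ ϖ) s (φ final ṽ)) f̃-base (CovH.over-≃ R≃ϖ (realizedWalk-lifts ev)))

  module Backward {ϖ : CW H (fun f v)} (F : V G̃ → V H̃) (actF : ∀ x → Act CH (proj₁ ϖ) (fun f̃ x) (F x))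
                  (eF : IsEqMultiHom f CG CH (sing f CG CH F)) where

    open IsEqMultiHom

    private
      isEqMultiHom : (m : EMH) → IsEqMultiHom f CG CH (proj₁ m)
      isEqMultiHom = proj₂

    private
      section : V G → V G̃
      section x = proj₁ (CovG.fibre-inhabited cG x)

      section-over : ∀ x → pG (section x) ≡ x
      section-over x = proj₂ (CovG.fibre-inhabited cG x)

    v' : V G
    v' = proj₁ (neighbour cG eG v)

    ev : E G v v'
    ev = proj₂ (neighbour cG eG v)

    private
      ṽ'Σ = N-surj CG ṽ v' (subst (λ q → E G q v') (≡.sym (p-base CG)) ev)
      ṽ' = proj₁ ṽ'Σ
      eṽ' = proj₁ (proj₂ ṽ'Σ)
      pṽ' = proj₂ (proj₂ ṽ'Σ)

    select : EMH → V G → V H̃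
    select m x = proj₁ (nonempty (isEqMultiHom m) (section x))

    select∈ : ∀ m x → proj₁ m (section x) (select m x)
    select∈ m x = proj₂ (nonempty (isEqMultiHom m) (section x))

    fibre-transfer : ∀ (m : EMH) {y y'} → pG y ≡ pG y' → ∀ {c} → proj₁ m y c →
                     Σ (V H̃) λ c' → proj₁ m y' c' × pH c' ≡ pH c
    fibre-transfer m eq {c} c∈ with CovG.act-transitive eq
    ... | γ , a with CovH.act-exists (f-loop γ) c
    ... | c' , ac = c' , equiv₂ (isEqMultiHom m) γ _ _ a c' (c , c∈ , ac) , CovH.act-fibre (f-loop γ) ac

    below-adjacent : ∀ (m₁ m₂ b : EMH) → m₁ ⊑ₘ b → m₂ ⊑ₘ b → Adjacent G H (pH ∘ select m₁) (pH ∘ select m₂)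
    below-adjacent m₁ m₂ b m₁⊑b m₂⊑b {x} {x'} e
      with N-surj CG (section x) x' (subst (λ q → E G q x') (≡.sym (section-over x)) e)
    ... | y , ey , py with fibre-transfer m₂ (trans (section-over x') (≡.sym py)) (select∈ m₂ x')
    ... | c' , c'∈ , pc' =
      subst (E H _) pc' (p-hom CH (edges (isEqMultiHom b) ey (m₁⊑b _ _ (select∈ m₁ x)) (m₂⊑b _ _ c'∈)))

    record Realization (m : EMH) : Set where
      field
        length     : ℕ
        path       : V G → ℕ → V H
        isXPath    : IsXPath G H length path
        path-start : ∀ x → path x 0 ≡ pH (select m x)
        path-end   : ∀ x → path x length ≡ fun f x
        origin     : V H̃
        origin∈    : proj₁ m ṽ origin
        lifted     : CovH.Over (zigzag (path v) (path v') length) origin (F ṽ)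

    private
      mF : EMH
      mF = sing f CG CH F , eF

      ⊑-refl : ∀ m → m ⊑ₘ m
      ⊑-refl _ _ _ c∈ = c∈

      F-over : ∀ y → pH (F y) ≡ fun f (pG y)
      F-over y = trans (CovH.act-fibre (proj₂ ϖ) (actF y)) (f̃-over y)

      select-F : ∀ x → pH (select mF x) ≡ fun f x
      select-F x = trans (cong pH (select∈ mF x)) (trans (F-over (section x)) (cong (fun f) (section-over x)))

      upper-bound : ∀ {m m'} → m ⊑ₘ m' ⊎ m' ⊑ₘ m → Σ EMH λ b → m ⊑ₘ b × m' ⊑ₘ b
      upper-bound {m' = m'} (inj₁ m⊑m') = m' , m⊑m' , ⊑-refl m'
      upper-bound {m = m}   (inj₂ m'⊑m) = m , ⊑-refl m , m'⊑m

    realization-F : Realization mF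
    realization-F = record
      { length     = 0
      ; path       = λ x _ → pH (select mF x)
      ; isXPath    = λ _ _ e _ → below-adjacent mF mF mF (⊑-refl mF) (⊑-refl mF) e
      ; path-start = λ _ → refl
      ; path-end   = select-F
      ; origin     = F ṽ
      ; origin∈     = refl
      ; lifted     = F ṽ ∷ [] , single _ ,
                     cong (_∷ []) (trans (F-over ṽ) (trans (cong (fun f) (p-base CG)) (≡.sym (select-F v))))
      }

    realization-step : ∀ {m m'} → m ⊑ₘ m' ⊎ m' ⊑ₘ m → Realization m' → Realization m
    realization-step {m} {m'} m~m' R = record
      { length     = suc length
      ; path       = prepend (pH ∘ select m) path
      ; isXPath    = xpath-prepend {G} {H} (below-adjacent m m b m⊑b m⊑b)
                       (λ e → subst (E H _) (≡.sym (path-start _)) (below-adjacent m m' b m⊑b m'⊑b e)) isXPath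
      ; path-start = λ _ → refl
      ; path-end   = path-end
      ; origin     = c
      ; origin∈     = c∈
      ; lifted     = c ∷ d ∷ proj₁ lifted ,
                     step (edges (isEqMultiHom m) eṽ' c∈ d∈)
                          (step (edges (isEqMultiHom b) (sym G̃ eṽ') (m⊑b _ _ d∈) (m'⊑b _ _ origin∈)) (proj₁ (proj₂ lifted))) ,
                     cong₂ _∷_ pc (cong₂ _∷_ pd (proj₂ (proj₂ lifted)))
      }
      where
        open Realization R
        upper = upper-bound {m} {m'} m~m'
        b = proj₁ upper
        m⊑b = proj₁ (proj₂ upper)
        m'⊑b = proj₂ (proj₂ upper)
        cΣ = fibre-transfer m (trans (section-over v) (≡.sym (p-base CG))) (select∈ m v)
        c = proj₁ cΣ
        c∈ = proj₁ (proj₂ cΣ)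
        pc = proj₂ (proj₂ cΣ)
        dΣ = fibre-transfer m (trans (section-over v') (≡.sym pṽ')) (select∈ m v')
        d = proj₁ dΣ
        d∈ = proj₁ (proj₂ dΣ)
        pd = proj₂ (proj₂ dΣ)

    realization : ∀ {m} → Star (λ m m' → m ⊑ₘ m' ⊎ m' ⊑ₘ m) m mF → Realization m
    realization ε          = realization-F
    realization (r ◅ rest) = realization-step r (realization rest)

    inPi : (ef : IsEqMultiHom f CG CH (sing f CG CH (fun f̃))) →
           SameComponent f CG CH (sing f CG CH F , eF) (sing f CG CH (fun f̃) , ef) → InPi f v ϖ
    inPi ef F~f̃ = length , T , v' , ev , realizedʷ ,
                  CovH.act-base-≃ (proj₂ ϖ) act (retarget origin≡w̃ refl (proj₁ (proj₂ lifted))) _ realized≡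
      where
        open Realization (realization (Star.reverse swap F~f̃))
        T : TimesHomotopy f length
        T = record
          { h = path ; hom = isXPath ; end = path-end
          ; start = λ x → trans (path-start x) (trans (cong pH (select∈ (sing f CG CH (fun f̃) , ef) x)) (trans (f̃-over (section x)) (cong (fun f) (section-over x)))) }
        origin≡w̃ : origin ≡ w̃
        origin≡w̃ = trans origin∈ f̃-base
        realized≡ : realizedWalk T v v' ≡ map pH (proj₁ lifted)
        realized≡ = trans (realizedWalk≡zigzag T v v') (≡.sym (proj₂ (proj₂ lifted)))
        realizedʷ : IsWalk H (fun f v) (fun f v) (realizedWalk T v v')
        realizedʷ = subst (IsWalk H _ _) (≡.sym realized≡)
          (retarget (trans (cong pH origin≡w̃) (p-base CH)) (trans (F-over ṽ) (cong (fun f) (p-base CG)))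
                    (CovH.project (proj₁ (proj₂ lifted))))
        act : Act CH (proj₁ ϖ) w̃ (F ṽ)
        act = subst (λ s → Act CH _ s (F ṽ)) f̃-base (actF ṽ)

theorem5p1 : (G H : Graph) → Finite G → Finite H → Connected G → Connected H →
    HasEdge G → HasEdge H →
    (f : Hom G H) (v : V G) →
    (CG : Universal2Covering G v) (CH : Universal2Covering H (fun f v)) →
    (f̃ : Hom (Cov CG) (Cov CH)) →
    fun f̃ (base CG) ≡ base CH →
    (∀ x → p CH (fun f̃ x) ≡ fun f (p CG x)) →
    (ϖ : CW H (fun f v)) →
    InPi f v ϖ ⇔
    Σ (V (Cov CG) → V (Cov CH)) λ F →
      (∀ x → Act CH (proj₁ ϖ) (fun f̃ x) (F x)) ×
      Σ (IsEqMultiHom f CG CH (sing f CG CH F)) λ eF →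
      Σ (IsEqMultiHom f CG CH (sing f CG CH (fun f̃))) λ ef →
      SameComponent f CG CH (sing f CG CH F , eF) (sing f CG CH (fun f̃) , ef)
theorem5p1 G H _ _ cG _ eG _ f v CG CH f̃ f̃-base f̃-over ϖ = mk⇔
  (λ { (n , T , v' , ev , _ , R≃ϖ) → let open S.Forward T in
       S.EquivariantLift.φ final , realized-act ev R≃ϖ ,
       proj₂ (S.singleton final) , proj₂ (S.singleton (level 0)) , level-component n })
  (λ { (F , actF , eF , ef , F~f̃) → S.Backward.inPi F actF eF ef F~f̃ })
  where
    module S = Setting cG eG f CG CH f̃ f̃-base f̃-over
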